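{- $g_{\mathbb{Z}_3[\sqrt[3]{3}]}(3) = 3$.
   Context: For a ring $R$ and an integer $k > 1$, let $R^k$ denote the additive semigroup generated by all $k$-th powers of elements of $R$. The Waring number $g_R(k)$ is the smallest positive integer such that every element of $R^k$ can be written as a sum of at most $g_R(k)$ $k$-th powers of elements of $R$. $\mathbb{Z}_3$ denotes the $3$-adic integers and $\mathbb{Z}_3[\sqrt[3]{3}]$ is the ring of integers of $\mathbb{Q}_3(\sqrt[3]{3})$. -}

module Defs where

open import Data.Nat using (ℕ; zero; suc; _+_; _*_; _^_; _<_; _≤_; NonZero)
open import Data.Nat.DivMod using (_%_)
open import Data.Nat.Properties using (m^n≢0)
open import Data.Product using (_×_; _,_; Σ)
open import Data.List using (List; []; _∷_; length)
open import Relation.Binary.PropositionalEquality using (_≡_)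

-- Z₃[∛3] ≅ Z₃[π]/(π³ - 3) = Z₃ ⊕ Z₃·π ⊕ Z₃·π² ,  and
--   Z₃[π] = lim_n  Z₃[π] / 3ⁿ  = lim_n  (Z/3ⁿ)[π]/(π³ - 3).
-- An element of (Z/3ⁿ)[π]/(π³-3) is a triple (a , b , c) meaning a + bπ + cπ²,
-- with a, b, c reduced representatives in [0, 3ⁿ).

Tri : Set
Tri = ℕ × ℕ × ℕ

_mod3^_ : ℕ → ℕ → ℕ
a mod3^ n = _%_ a (3 ^ n) {{m^n≢0 3 n}}

red : ℕ → Tri → Tri
red n (a , b , c) = (a mod3^ n , b mod3^ n , c mod3^ n)

addT : Tri → Tri → Tri
addT (a , b , c) (a' , b' , c') = (a + a' , b + b' , c + c')

-- multiplication in Z[π]/(π³ - 3)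
mulT : Tri → Tri → Tri
mulT (a , b , c) (a' , b' , c') =
  ( a * a' + 3 * (b * c' + c * b')
  , a * b' + b * a' + 3 * (c * c')
  , a * c' + b * b' + c * a' )

zeroT : Tri
zeroT = (0 , 0 , 0)

cubeT : Tri → Tri
cubeT t = mulT t (mulT t t)

-- The ring of integers O = Z₃[∛3] as the inverse limit of O/3ⁿO:
-- coherent sequences of reduced triples.
record 𝒪 : Set where
  field
    at       : ℕ → Tri
    reduced  : ∀ n → red n (at n) ≡ at n
    coherent : ∀ n → red n (at (suc n)) ≡ at n
open 𝒪 public

_≈_ : 𝒪 → 𝒪 → Set
x ≈ y = ∀ n → at x n ≡ at y n

sumCubesAt : ℕ → List 𝒪 → Tri
sumCubesAt n []       = zeroT
sumCubesAt n (y ∷ ys) = addT (cubeT (at y n)) (sumCubesAt n ys)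

IsSumOfCubes : 𝒪 → List 𝒪 → Set
IsSumOfCubes x ys = ∀ n → at x n ≡ red n (sumCubesAt n ys)

-- x lies in O³, the additive semigroup generated by cubes
-- (a sum of a nonempty finite list of cubes)
InCubeSemigroup : 𝒪 → Set
InCubeSemigroup x = Σ (List 𝒪) (λ ys → 1 ≤ length ys × IsSumOfCubes x ys)

SumOfAtMost : ℕ → 𝒪 → Set
SumOfAtMost k x = Σ (List 𝒪) (λ ys → length ys ≤ k × IsSumOfCubes x ys)

{-# OPTIONS --safe #-}
-- An element of 𝒪 is a coherent sequence of residues modulo 3ⁿ; we compute with
-- integral representatives in ℤ[π], π³ = 3.
--
-- The π- and π²-coefficients of a cube are divisible by 3,
-- hence so are those of any x ∈ 𝒪³, and an exhaustive search modulo 9 gives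
-- x ≡ r³ + a³ + b³ (mod 9) with r a unit modulo 3. Hensel's lemma then lifts r:
-- if t³ + a³ + b³ ≡ x (mod 3ᵏ⁺²), write the difference as 3ᵏ⁺² q and put
-- t′ = t + 3ᵏ⁺¹ q w with r² w ≡ 1 (mod 3); expanding (t + 3ᵏ⁺¹ q w)³ gives
-- t′³ + a³ + b³ ≡ x (mod 3ᵏ⁺³), while t′ ≡ t (mod 3ᵏ⁺¹).
--
-- Two do not. x₀ = π³ + 1³ + (2 + π²)³ = 21 + 18π + 12π² is ≡ 3 + 3π² (mod 9),
-- y³ modulo 9 depends only on y modulo 3, and no two cubes of residues modulo 3
-- sum to 3 + 3π² modulo 9.
module Submission where

open import Algebra.Bundles using (CommutativeRing; Semiring)
open import Algebra.Consequences.Propositional using (comm∧idˡ⇒idʳ; comm∧invˡ⇒invʳ; comm∧distrˡ⇒distrʳ)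
import Algebra.Definitions.RawMagma as RawMagmaDefinitions
import Algebra.Definitions.RawSemiring as RawSemiringDefinitions
import Algebra.Solver.Ring.NaturalCoefficients.Default as NaturalCoefficientsSolver
open import Data.Integer.Base as ℤ using (ℤ; +_; -[1+_])
import Data.Integer.DivMod as ℤ
import Data.Integer.Properties as ℤ
open import Data.Integer.Tactic.RingSolver using (solve-∀)
open import Data.List.Base using (List; []; _∷_; length; map; foldr; upTo; cartesianProduct)
open import Data.List.Membership.Propositional using (_∈_)
open import Data.List.Membership.Propositional.Properties using (∈-upTo⁺; ∈-cartesianProduct⁺)
open import Data.List.Relation.Binary.Pointwise as Pointwise using (Pointwise; []; _∷_)
open import Data.List.Relation.Unary.All as All using (All; all?)
open import Data.List.Relation.Unary.Any as Any using (Any; any?; here)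
open import Data.Nat.Base as ℕ using (ℕ; zero; suc; _≤_; s≤s; z≤n)
import Data.Nat.DivMod as ℕ
import Data.Nat.Divisibility as ℕ
import Data.Nat.Properties as ℕ
import Data.Nat.Tactic.RingSolver as ℕ-Solver
open import Data.Product.Base using (Σ; Σ-syntax; ∃-syntax; _×_; _,_; proj₁; proj₂)
open import Data.Product.Properties using (≡-dec)
open import Level using (0ℓ; _⊔_)
open import Relation.Binary.Bundles using (Setoid)
open import Relation.Binary.Definitions using (DecidableEquality)
open import Relation.Binary.PropositionalEquality
  using (_≡_; _≢_; refl; sym; trans; cong; cong₂; subst; isEquivalence)
import Relation.Binary.Reasoning.Setoid as SetoidReasoning
open import Relation.Nullary using (¬_)
open import Relation.Nullary.Decidable using (Dec; _×-dec_; _→-dec_; ¬?; toWitness)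

open import Defs hiding (_≈_)

module Congruence {a ℓ} (R : CommutativeRing a ℓ) where

  open CommutativeRing R renaming (refl to ≈-refl)
  open RawMagmaDefinitions *-rawMagma using (_∣_; _,_)
  open NaturalCoefficientsSolver commutativeSemiring using (solve; _:=_; _:+_; _:*_)
  open SetoidReasoning setoid

  infix 4 _≡_mod_

  -- A record rather than a Σ-type, so that x, y and m are recovered by unification.
  record _≡_mod_ (x y m : Carrier) : Set (a ⊔ ℓ) where
    constructor _,_
    field
      quotient : Carrier
      equation : x ≈ y + quotient * m

  open _≡_mod_ public

  ≡-mod-reflexive : ∀ {m x y} → x ≈ y → x ≡ y mod m
  ≡-mod-reflexive {m} {x} {y} x≈y = 0# , (begin
    x           ≈⟨ x≈y ⟩
    y           ≈⟨ +-identityʳ y ⟨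
    y + 0#      ≈⟨ +-congˡ (zeroˡ m) ⟨
    y + 0# * m  ∎)

  ≡-mod-refl : ∀ {m x} → x ≡ x mod m
  ≡-mod-refl = ≡-mod-reflexive ≈-refl

  ≡-mod-sym : ∀ {m x y} → x ≡ y mod m → y ≡ x mod m
  ≡-mod-sym {m} {x} {y} (q , x≈y+qm) = - q , (begin
    y                      ≈⟨ +-identityʳ y ⟨
    y + 0#                 ≈⟨ +-congˡ (zeroˡ m) ⟨
    y + 0# * m             ≈⟨ +-congˡ (*-congʳ (-‿inverseʳ q)) ⟨
    y + (q + - q) * m      ≈⟨ +-congˡ (distribʳ m q (- q)) ⟩
    y + (q * m + - q * m)  ≈⟨ +-assoc y (q * m) (- q * m) ⟨
    y + q * m + - q * m    ≈⟨ +-congʳ x≈y+qm ⟨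
    x + - q * m            ∎)

  ≡-mod-trans : ∀ {m x y z} → x ≡ y mod m → y ≡ z mod m → x ≡ z mod m
  ≡-mod-trans {m} {x} {y} {z} (q , x≈y+qm) (p , y≈z+pm) = p + q , (begin
    x                    ≈⟨ x≈y+qm ⟩
    y + q * m            ≈⟨ +-congʳ y≈z+pm ⟩
    z + p * m + q * m    ≈⟨ solve 4 (λ z p q m → z :+ p :* m :+ q :* m := z :+ (p :+ q) :* m) ≈-refl z p q m ⟩
    z + (p + q) * m      ∎)

  ≡-mod-+-cong : ∀ {m x y u v} → x ≡ y mod m → u ≡ v mod m → x + u ≡ y + v mod m
  ≡-mod-+-cong {m} {x} {y} {u} {v} (q , x≈y+qm) (p , u≈v+pm) = q + p , (begin
    x + u                      ≈⟨ +-cong x≈y+qm u≈v+pm ⟩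
    (y + q * m) + (v + p * m)  ≈⟨ solve 5 (λ y v q p m → (y :+ q :* m) :+ (v :+ p :* m) := (y :+ v) :+ (q :+ p) :* m) ≈-refl y v q p m ⟩
    (y + v) + (q + p) * m      ∎)

  ≡-mod-*-cong : ∀ {m x y u v} → x ≡ y mod m → u ≡ v mod m → x * u ≡ y * v mod m
  ≡-mod-*-cong {m} {x} {y} {u} {v} (q , x≈y+qm) (p , u≈v+pm) = q * v + y * p + q * p * m , (begin
    x * u                                    ≈⟨ *-cong x≈y+qm u≈v+pm ⟩
    (y + q * m) * (v + p * m)                ≈⟨ solve 5 (λ y v q p m → (y :+ q :* m) :* (v :+ p :* m) := y :* v :+ (q :* v :+ y :* p :+ q :* p :* m) :* m) ≈-refl y v q p m ⟩
    y * v + (q * v + y * p + q * p * m) * m  ∎)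

  ≡-mod-weaken : ∀ {m n x y} → m ∣ n → x ≡ y mod n → x ≡ y mod m
  ≡-mod-weaken {m} {n} {x} {y} (d , dm≈n) (q , x≈y+qn) = q * d , (begin
    x                ≈⟨ x≈y+qn ⟩
    y + q * n        ≈⟨ +-congˡ (*-congˡ dm≈n) ⟨
    y + q * (d * m)  ≈⟨ +-congˡ (*-assoc q d m) ⟨
    y + q * d * m    ∎)

  ≡-mod-setoid : Carrier → Setoid a (a ⊔ ℓ)
  ≡-mod-setoid m = record
    { _≈_           = _≡_mod m
    ; isEquivalence = record { refl = ≡-mod-refl ; sym = ≡-mod-sym ; trans = ≡-mod-trans }
    }

  module ≡-mod-Reasoning (m : Carrier) = SetoidReasoning (≡-mod-setoid m)

module CubesModuloPowersOfThree {a ℓ} (R : CommutativeRing a ℓ) where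

  open CommutativeRing R renaming (refl to ≈-refl)
  open RawSemiringDefinitions (Semiring.rawSemiring semiring) public using (_^_)
  open RawMagmaDefinitions *-rawMagma using (_,_)
  open NaturalCoefficientsSolver commutativeSemiring using (solve; _:=_; _:+_; _:*_; con)
  open SetoidReasoning setoid
  open Congruence R

  3# : Carrier
  3# = 1# + 1# + 1#

  ≡-mod-3^-pred : ∀ n {x y} → x ≡ y mod 3# ^ suc n → x ≡ y mod 3# ^ n
  ≡-mod-3^-pred n = ≡-mod-weaken (3# , ≈-refl)

  cube : Carrier → Carrier
  cube x = x * (x * x)

  cube-≡-mod : ∀ {m x y} → x ≡ y mod m → cube x ≡ cube y mod m
  cube-≡-mod x≡y = ≡-mod-*-cong x≡y (≡-mod-*-cong x≡y x≡y)

  cube-≡-mod-3 : ∀ {x y} → x ≡ y mod 3# → cube x ≡ cube y mod 3# ^ 2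
  cube-≡-mod-3 {x} {y} (q , x≈y+q3) = y * y * q + y * q * q * 3# + q * q * q * 3# , (begin
    cube x             ≈⟨ *-cong x≈y+q3 (*-cong x≈y+q3 x≈y+q3) ⟩
    cube (y + q * 3#)  ≈⟨ solve 2 (λ y q → (y :+ q :* con 3) :* ((y :+ q :* con 3) :* (y :+ q :* con 3))
                                           := y :* (y :* y) :+ (y :* y :* q :+ y :* q :* q :* con 3 :+ q :* q :* q :* con 3) :* (con 3 :* (con 3 :* con 1)))
                                  ≈-refl y q ⟩
    cube y + (y * y * q + y * q * q * 3# + q * q * q * 3#) * 3# ^ 2 ∎)

  sumOfCubes : List Carrier → Carrier
  sumOfCubes = foldr (λ x s → cube x + s) 0#

  sumOfCubes-≡-mod : ∀ {m xs ys} → Pointwise (_≡_mod m) xs ys → sumOfCubes xs ≡ sumOfCubes ys mod m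
  sumOfCubes-≡-mod []            = ≡-mod-refl
  sumOfCubes-≡-mod (x≡y ∷ xs≡ys) = ≡-mod-+-cong (cube-≡-mod x≡y) (sumOfCubes-≡-mod xs≡ys)

  sumOfCubes-≡-mod-3 : ∀ {xs ys} → Pointwise (_≡_mod 3#) xs ys → sumOfCubes xs ≡ sumOfCubes ys mod 3# ^ 2
  sumOfCubes-≡-mod-3 []            = ≡-mod-refl
  sumOfCubes-≡-mod-3 (x≡y ∷ xs≡ys) = ≡-mod-+-cong (cube-≡-mod-3 x≡y) (sumOfCubes-≡-mod-3 xs≡ys)

  cube-newton-step : ∀ {t w} q T → t * t * w ≡ 1# mod 3# →
                     cube (t + q * (3# * T) * w) ≡ cube t + q * (3# * (3# * T)) mod 3# * (3# * (3# * T))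
  cube-newton-step {t} {w} q T (v , t²w≈1+v3) = q * v + e , (begin
    cube (t + q * (3# * T) * w)
      ≈⟨ solve 4 (λ t w q T → (t :+ q :* (con 3 :* T) :* w) :* ((t :+ q :* (con 3 :* T) :* w) :* (t :+ q :* (con 3 :* T) :* w))
                            := t :* (t :* t) :+ q :* (con 3 :* (con 3 :* T)) :* (t :* t :* w)
                               :+ (t :* q :* q :* T :* w :* w :+ q :* q :* q :* T :* T :* w :* w :* w) :* (con 3 :* (con 3 :* (con 3 :* T))))
                  ≈-refl t w q T ⟩
    cube t + q * (3# * (3# * T)) * (t * t * w) + e * (3# * (3# * (3# * T)))
      ≈⟨ +-congʳ (+-congˡ (*-congˡ t²w≈1+v3)) ⟩
    cube t + q * (3# * (3# * T)) * (1# + v * 3#) + e * (3# * (3# * (3# * T)))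
      ≈⟨ solve 5 (λ t³ q v T e → t³ :+ q :* (con 3 :* (con 3 :* T)) :* (con 1 :+ v :* con 3) :+ e :* (con 3 :* (con 3 :* (con 3 :* T)))
                                := t³ :+ q :* (con 3 :* (con 3 :* T)) :+ (q :* v :+ e) :* (con 3 :* (con 3 :* (con 3 :* T))))
                  ≈-refl (cube t) q v T e ⟩
    cube t + q * (3# * (3# * T)) + (q * v + e) * (3# * (3# * (3# * T))) ∎)
    where
    e : Carrier
    e = t * q * q * T * w * w + q * q * q * T * T * w * w * w

  Coherent : (ℕ → Carrier) → Set (a ⊔ ℓ)
  Coherent u = ∀ n → u (suc n) ≡ u n mod 3# ^ n

  module _ {u : ℕ → Carrier} (u-coherent : Coherent u) {c r w : Carrier}
           (r³+c≡u₂ : cube r + c ≡ u 2 mod 3# ^ 2) (r²w≡1 : r * r * w ≡ 1# mod 3#) where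

    Approximation : ℕ → Carrier → Set (a ⊔ ℓ)
    Approximation k t = (cube t + c ≡ u (2 ℕ.+ k) mod 3# ^ (2 ℕ.+ k)) × (t ≡ r mod 3#)

    refine : ∀ k {t} → Approximation k t → Σ[ t′ ∈ Carrier ] Approximation (suc k) t′ × t′ ≡ t mod 3# ^ suc k
    refine k {t} (t³+c≡u , t≡r) = t′ , (t′³+c≡u , ≡-mod-trans (≡-mod-weaken (T , *-comm T 3#) t′≡t) t≡r) , t′≡t
      where
      T : Carrier
      T = 3# ^ k
      u≡t³+c : u (3 ℕ.+ k) ≡ cube t + c mod 3# ^ (2 ℕ.+ k)
      u≡t³+c = ≡-mod-trans (u-coherent (2 ℕ.+ k)) (≡-mod-sym t³+c≡u)
      q : Carrier
      q = quotient u≡t³+c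
      t′ : Carrier
      t′ = t + q * (3# * T) * w
      t′≡t : t′ ≡ t mod 3# * T
      t′≡t = q * w , solve 4 (λ t q T w → t :+ q :* (con 3 :* T) :* w := t :+ q :* w :* (con 3 :* T)) ≈-refl t q T w
      t²w≡1 : t * t * w ≡ 1# mod 3#
      t²w≡1 = ≡-mod-trans (≡-mod-*-cong (≡-mod-*-cong t≡r t≡r) ≡-mod-refl) r²w≡1
      t′³+c≡u : cube t′ + c ≡ u (3 ℕ.+ k) mod 3# ^ (3 ℕ.+ k)
      t′³+c≡u = ≡-mod-trans (≡-mod-+-cong (cube-newton-step q T t²w≡1) ≡-mod-refl) (≡-mod-reflexive (begin
        cube t + q * (3# * (3# * T)) + c  ≈⟨ solve 4 (λ t³ q T c → t³ :+ q :* (con 3 :* (con 3 :* T)) :+ c := t³ :+ c :+ q :* (con 3 :* (con 3 :* T))) ≈-refl (cube t) q T c ⟩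
        cube t + c + q * (3# * (3# * T))  ≈⟨ equation u≡t³+c ⟨
        u (3 ℕ.+ k)                       ∎))

    approximation : ∀ k → Σ Carrier (Approximation k)
    approximation zero    = r , r³+c≡u₂ , ≡-mod-refl
    approximation (suc k) = proj₁ refined , proj₁ (proj₂ refined)
      where
      refined : Σ[ t′ ∈ Carrier ] Approximation (suc k) t′ × t′ ≡ proj₁ (approximation k) mod 3# ^ suc k
      refined = refine k (proj₂ (approximation k))

    hensel-cube : Σ[ s ∈ (ℕ → Carrier) ] Coherent s × (∀ n → cube (s n) + c ≡ u n mod 3# ^ n)
    hensel-cube = s , s-coherent , s³+c≡u
      where
      s : ℕ → Carrier
      s n = proj₁ (approximation n)
      s-coherent : Coherent s
      s-coherent n = ≡-mod-3^-pred n (proj₂ (proj₂ (refine n (proj₂ (approximation n)))))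
      s³+c≡u : ∀ n → cube (s n) + c ≡ u n mod 3# ^ n
      s³+c≡u n = ≡-mod-trans (≡-mod-3^-pred n (≡-mod-3^-pred (suc n) (proj₁ (proj₂ (approximation n)))))
                  (≡-mod-trans (≡-mod-3^-pred n (u-coherent (suc n))) (u-coherent n))

-- (a , b , c) stands for a + bπ + cπ² with π³ = 3, as for Tri in Defs.
ℤ[∛3] : Set
ℤ[∛3] = ℤ × ℤ × ℤ

infixl 6 _⊕_
infixl 7 _⊗_

_⊕_ : ℤ[∛3] → ℤ[∛3] → ℤ[∛3]
(a , b , c) ⊕ (d , e , f) = (a ℤ.+ d , b ℤ.+ e , c ℤ.+ f)

⊖_ : ℤ[∛3] → ℤ[∛3]
⊖ (a , b , c) = (ℤ.- a , ℤ.- b , ℤ.- c)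

_⊗_ : ℤ[∛3] → ℤ[∛3] → ℤ[∛3]
(a , b , c) ⊗ (d , e , f) =
  ( a ℤ.* d ℤ.+ + 3 ℤ.* (b ℤ.* f ℤ.+ c ℤ.* e)
  , a ℤ.* e ℤ.+ b ℤ.* d ℤ.+ + 3 ℤ.* (c ℤ.* f)
  , a ℤ.* f ℤ.+ b ℤ.* e ℤ.+ c ℤ.* d )

triple-≡ : ∀ {A : Set} {a b c d e f : A} → a ≡ d → b ≡ e → c ≡ f → (a , b , c) ≡ (d , e , f)
triple-≡ refl refl refl = refl

triple-≡⁻ : ∀ {A : Set} {a b c d e f : A} → (a , b , c) ≡ (d , e , f) → a ≡ d × b ≡ e × c ≡ f
triple-≡⁻ refl = refl , refl , refl

⊕-assoc : ∀ x y z → (x ⊕ y) ⊕ z ≡ x ⊕ (y ⊕ z)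
⊕-assoc (a , b , c) (d , e , f) (g , h , i) = triple-≡ (ℤ.+-assoc a d g) (ℤ.+-assoc b e h) (ℤ.+-assoc c f i)

⊕-comm : ∀ x y → x ⊕ y ≡ y ⊕ x
⊕-comm (a , b , c) (d , e , f) = triple-≡ (ℤ.+-comm a d) (ℤ.+-comm b e) (ℤ.+-comm c f)

⊕-identityˡ : ∀ x → (+ 0 , + 0 , + 0) ⊕ x ≡ x
⊕-identityˡ (a , b , c) = triple-≡ (ℤ.+-identityˡ a) (ℤ.+-identityˡ b) (ℤ.+-identityˡ c)

⊕-inverseˡ : ∀ x → ⊖ x ⊕ x ≡ (+ 0 , + 0 , + 0)
⊕-inverseˡ (a , b , c) = triple-≡ (ℤ.+-inverseˡ a) (ℤ.+-inverseˡ b) (ℤ.+-inverseˡ c)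

module _ where
  open import Data.Integer.Base using (_+_; _*_)

  ⊗-assoc : ∀ x y z → (x ⊗ y) ⊗ z ≡ x ⊗ (y ⊗ z)
  ⊗-assoc (a , b , c) (d , e , f) (g , h , i) =
    triple-≡ (assoc₁ a b c d e f g h i) (assoc₂ a b c d e f g h i) (assoc₃ a b c d e f g h i)
    where
    assoc₁ : ∀ a b c d e f g h i →
      (a * d + + 3 * (b * f + c * e)) * g + + 3 * ((a * e + b * d + + 3 * (c * f)) * i + (a * f + b * e + c * d) * h)
        ≡ a * (d * g + + 3 * (e * i + f * h)) + + 3 * (b * (d * i + e * h + f * g) + c * (d * h + e * g + + 3 * (f * i)))
    assoc₁ = solve-∀
    assoc₂ : ∀ a b c d e f g h i →
      (a * d + + 3 * (b * f + c * e)) * h + (a * e + b * d + + 3 * (c * f)) * g + + 3 * ((a * f + b * e + c * d) * i)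
        ≡ a * (d * h + e * g + + 3 * (f * i)) + b * (d * g + + 3 * (e * i + f * h)) + + 3 * (c * (d * i + e * h + f * g))
    assoc₂ = solve-∀
    assoc₃ : ∀ a b c d e f g h i →
      (a * d + + 3 * (b * f + c * e)) * i + (a * e + b * d + + 3 * (c * f)) * h + (a * f + b * e + c * d) * g
        ≡ a * (d * i + e * h + f * g) + b * (d * h + e * g + + 3 * (f * i)) + c * (d * g + + 3 * (e * i + f * h))
    assoc₃ = solve-∀

  ⊗-comm : ∀ x y → x ⊗ y ≡ y ⊗ x
  ⊗-comm (a , b , c) (d , e , f) = triple-≡ (comm₁ a b c d e f) (comm₂ a b c d e f) (comm₃ a b c d e f)
    where
    comm₁ : ∀ a b c d e f → a * d + + 3 * (b * f + c * e) ≡ d * a + + 3 * (e * c + f * b)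
    comm₁ = solve-∀
    comm₂ : ∀ a b c d e f → a * e + b * d + + 3 * (c * f) ≡ d * b + e * a + + 3 * (f * c)
    comm₂ = solve-∀
    comm₃ : ∀ a b c d e f → a * f + b * e + c * d ≡ d * c + e * b + f * a
    comm₃ = solve-∀

  ⊗-distribˡ : ∀ x y z → x ⊗ (y ⊕ z) ≡ x ⊗ y ⊕ x ⊗ z
  ⊗-distribˡ (a , b , c) (d , e , f) (g , h , i) =
    triple-≡ (distrib₁ a b c d e f g h i) (distrib₂ a b c d e f g h i) (distrib₃ a b c d e f g h i)
    where
    distrib₁ : ∀ a b c d e f g h i →
      a * (d + g) + + 3 * (b * (f + i) + c * (e + h)) ≡ a * d + + 3 * (b * f + c * e) + (a * g + + 3 * (b * i + c * h))
    distrib₁ = solve-∀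
    distrib₂ : ∀ a b c d e f g h i →
      a * (e + h) + b * (d + g) + + 3 * (c * (f + i)) ≡ a * e + b * d + + 3 * (c * f) + (a * h + b * g + + 3 * (c * i))
    distrib₂ = solve-∀
    distrib₃ : ∀ a b c d e f g h i →
      a * (f + i) + b * (e + h) + c * (d + g) ≡ a * f + b * e + c * d + (a * i + b * h + c * g)
    distrib₃ = solve-∀

  ⊗-identityˡ : ∀ x → (+ 1 , + 0 , + 0) ⊗ x ≡ x
  ⊗-identityˡ (a , b , c) = triple-≡ (identity₁ a b c) (identity₂ a b c) (identity₃ a b c)
    where
    identity₁ : ∀ a b c → + 1 * a + + 3 * (+ 0 * c + + 0 * b) ≡ a
    identity₁ = solve-∀
    identity₂ : ∀ a b c → + 1 * b + + 0 * a + + 3 * (+ 0 * c) ≡ b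
    identity₂ = solve-∀
    identity₃ : ∀ a b c → + 1 * c + + 0 * b + + 0 * a ≡ c
    identity₃ = solve-∀

  ⊗-scalar : ∀ a b c d → (a , b , c) ⊗ (d , + 0 , + 0) ≡ (a * d , b * d , c * d)
  ⊗-scalar a b c d = triple-≡ (scalar₁ a b c d) (scalar₂ a b c d) (scalar₃ a b c d)
    where
    scalar₁ : ∀ a b c d → a * d + + 3 * (b * + 0 + c * + 0) ≡ a * d
    scalar₁ = solve-∀
    scalar₂ : ∀ a b c d → a * + 0 + b * d + + 3 * (c * + 0) ≡ b * d
    scalar₂ = solve-∀
    scalar₃ : ∀ a b c d → a * + 0 + b * + 0 + c * d ≡ c * d
    scalar₃ = solve-∀

ℤ[∛3]-commutativeRing : CommutativeRing 0ℓ 0ℓ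
ℤ[∛3]-commutativeRing = record
  { Carrier = ℤ[∛3] ; _≈_ = _≡_ ; _+_ = _⊕_ ; _*_ = _⊗_ ; -_ = ⊖_ ; 0# = (+ 0 , + 0 , + 0) ; 1# = (+ 1 , + 0 , + 0)
  ; isCommutativeRing = record
    { isRing = record
      { +-isAbelianGroup = record
        { isGroup = record
          { isMonoid = record
            { isSemigroup = record
              { isMagma = record { isEquivalence = isEquivalence ; ∙-cong = cong₂ _⊕_ }
              ; assoc = ⊕-assoc }
            ; identity = ⊕-identityˡ , comm∧idˡ⇒idʳ ⊕-comm ⊕-identityˡ }
          ; inverse = ⊕-inverseˡ , comm∧invˡ⇒invʳ ⊕-comm ⊕-inverseˡ
          ; ⁻¹-cong = cong ⊖_ }
        ; comm = ⊕-comm }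
      ; *-cong = cong₂ _⊗_
      ; *-assoc = ⊗-assoc
      ; *-identity = ⊗-identityˡ , comm∧idˡ⇒idʳ ⊗-comm ⊗-identityˡ
      ; distrib = ⊗-distribˡ , comm∧distrˡ⇒distrʳ ⊗-comm ⊗-distribˡ }
    ; *-comm = ⊗-comm } }

open Congruence ℤ[∛3]-commutativeRing
open CubesModuloPowersOfThree ℤ[∛3]-commutativeRing

ι : Tri → ℤ[∛3]
ι (a , b , c) = (+ a , + b , + c)

ι-mulT : ∀ s t → ι (mulT s t) ≡ ι s ⊗ ι t
ι-mulT (a , b , c) (d , e , f) = triple-≡
  (cong₂ ℤ._+_ (ℤ.pos-* a d) (3* (cong₂ ℤ._+_ (ℤ.pos-* b f) (ℤ.pos-* c e))))
  (cong₂ ℤ._+_ (cong₂ ℤ._+_ (ℤ.pos-* a e) (ℤ.pos-* b d)) (3* (ℤ.pos-* c f)))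
  (cong₂ ℤ._+_ (cong₂ ℤ._+_ (ℤ.pos-* a f) (ℤ.pos-* b e)) (ℤ.pos-* c d))
  where
  3* : ∀ {m x} → + m ≡ x → + (3 ℕ.* m) ≡ + 3 ℤ.* x
  3* {m} m≡x = trans (ℤ.pos-* 3 m) (cong (+ 3 ℤ.*_) m≡x)

ι-cubeT : ∀ t → ι (cubeT t) ≡ cube (ι t)
ι-cubeT t = trans (ι-mulT t (mulT t t)) (cong (ι t ⊗_) (ι-mulT t t))

3^n≡ : ∀ n → 3# ^ n ≡ (+ (3 ℕ.^ n) , + 0 , + 0)
3^n≡ zero    = refl
3^n≡ (suc n) = trans (cong (3# ⊗_) (3^n≡ n))
  (cong (λ k → (k , + 0 , + 0)) (trans (ℤ.+-identityʳ _) (sym (ℤ.pos-* 3 (3 ℕ.^ n)))))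

⊗-3^n : ∀ n a b c → (a , b , c) ⊗ 3# ^ n ≡ (a ℤ.* + (3 ℕ.^ n) , b ℤ.* + (3 ℕ.^ n) , c ℤ.* + (3 ℕ.^ n))
⊗-3^n n a b c = trans (cong ((a , b , c) ⊗_) (3^n≡ n)) (⊗-scalar a b c (+ (3 ℕ.^ n)))

module _ (n : ℕ) where

  private instance
    3^n≢0 : ℕ.NonZero (3 ℕ.^ n)
    3^n≢0 = ℕ.m^n≢0 3 n

  toTri : ℤ[∛3] → Tri
  toTri (a , b , c) = (a ℤ.%ℕ 3 ℕ.^ n , b ℤ.%ℕ 3 ℕ.^ n , c ℤ.%ℕ 3 ℕ.^ n)

  ≡-toTri : ∀ x → x ≡ ι (toTri x) mod 3# ^ n
  ≡-toTri x@(a , b , c) = (a ℤ./ℕ 3 ℕ.^ n , b ℤ./ℕ 3 ℕ.^ n , c ℤ./ℕ 3 ℕ.^ n) ,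
    trans (triple-≡ (ℤ.a≡a%ℕn+[a/ℕn]*n a (3 ℕ.^ n)) (ℤ.a≡a%ℕn+[a/ℕn]*n b (3 ℕ.^ n)) (ℤ.a≡a%ℕn+[a/ℕn]*n c (3 ℕ.^ n)))
          (cong (ι (toTri x) ⊕_) (sym (⊗-3^n n (a ℤ./ℕ 3 ℕ.^ n) (b ℤ./ℕ 3 ℕ.^ n) (c ℤ./ℕ 3 ℕ.^ n))))

  red-toTri : ∀ x → red n (toTri x) ≡ toTri x
  red-toTri (a , b , c) = triple-≡ (%-idem a) (%-idem b) (%-idem c)
    where
    %-idem : ∀ z → (z ℤ.%ℕ 3 ℕ.^ n) ℕ.% 3 ℕ.^ n ≡ z ℤ.%ℕ 3 ℕ.^ n
    %-idem z = ℕ.m<n⇒m%n≡m (ℤ.n%ℕd<d z (3 ℕ.^ n))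

%-cong⁺ : ∀ {a b k d} .{{_ : ℕ.NonZero d}} → + a ≡ + b ℤ.+ + k ℤ.* + d → a ℕ.% d ≡ b ℕ.% d
%-cong⁺ {b = b} {k} {d} eq = trans (cong (ℕ._% d) (ℤ.+-injective (trans eq (cong (λ z → + b ℤ.+ z) (sym (ℤ.pos-* k d))))))
                                   (ℕ.[m+kn]%n≡m%n b k d)

%-cong : ∀ {a b d} .{{_ : ℕ.NonZero d}} q → + a ≡ + b ℤ.+ q ℤ.* + d → a ℕ.% d ≡ b ℕ.% d
%-cong         (+ k)    a≡b+kd = %-cong⁺ {k = k} a≡b+kd
%-cong {a} {b} {d} -[1+ k ] a≡b-kd =
  sym (%-cong⁺ {k = suc k} (trans (flip (+ b) -[1+ k ] (+ d)) (cong (ℤ._+ + suc k ℤ.* + d) (sym a≡b-kd))))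
  where
  flip : ∀ y q z → y ≡ y ℤ.+ q ℤ.* z ℤ.+ ℤ.- q ℤ.* z
  flip = solve-∀

red-cong : ∀ n {s t} → ι s ≡ ι t mod 3# ^ n → red n s ≡ red n t
red-cong n {a , b , c} {a′ , b′ , c′} ((q₁ , q₂ , q₃) , ιs≡ιt+q3ⁿ)
  with triple-≡⁻ (trans ιs≡ιt+q3ⁿ (cong (ι (a′ , b′ , c′) ⊕_) (⊗-3^n n q₁ q₂ q₃)))
... | a≡ , b≡ , c≡ = triple-≡ (%-cong {a} {a′} q₁ a≡) (%-cong {b} {b′} q₂ b≡) (%-cong {c} {c′} q₃ c≡)
  where instance _ = ℕ.m^n≢0 3 n

≡-mod-red : ∀ n {s t} → red n s ≡ t → ι s ≡ ι t mod 3# ^ n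
≡-mod-red n {s} refl = ≡-toTri n (ι s)

fromCoherent : (s : ℕ → ℤ[∛3]) → Coherent s → 𝒪
fromCoherent s s-coherent = record
  { at       = λ n → toTri n (s n)
  ; reduced  = λ n → red-toTri n (s n)
  ; coherent = λ n → trans (red-cong n (ι-toTri-coherent n)) (red-toTri n (s n))
  }
  where
  ι-toTri-coherent : ∀ n → ι (toTri (suc n) (s (suc n))) ≡ ι (toTri n (s n)) mod 3# ^ n
  ι-toTri-coherent n = ≡-mod-trans (≡-mod-3^-pred n (≡-mod-sym (≡-toTri (suc n) (s (suc n)))))
                                    (≡-mod-trans (s-coherent n) (≡-toTri n (s n)))

atℤ : 𝒪 → ℕ → ℤ[∛3]
atℤ x n = ι (at x n)

atℤ-fromCoherent : ∀ s s-coherent n → atℤ (fromCoherent s s-coherent) n ≡ s n mod 3# ^ n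
atℤ-fromCoherent s _ n = ≡-mod-sym (≡-toTri n (s n))

const : Tri → 𝒪
const t = fromCoherent (λ _ → ι t) (λ _ → ≡-mod-refl)

atℤ-const : ∀ t n → atℤ (const t) n ≡ ι t mod 3# ^ n
atℤ-const t = atℤ-fromCoherent (λ _ → ι t) (λ _ → ≡-mod-refl)

atℤ-coherent : ∀ x → Coherent (atℤ x)
atℤ-coherent x n = subst (λ t → atℤ x (suc n) ≡ ι t mod 3# ^ n) (coherent x n) (≡-toTri n (atℤ x (suc n)))

sumCubesT : List Tri → Tri
sumCubesT = foldr (λ t s → addT (cubeT t) s) zeroT

ι-sumCubesT : ∀ ts → ι (sumCubesT ts) ≡ sumOfCubes (map ι ts)
ι-sumCubesT []       = refl
ι-sumCubesT (t ∷ ts) = cong₂ _⊕_ (ι-cubeT t) (ι-sumCubesT ts)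

ι-sumCubesAt : ∀ n ys → ι (sumCubesAt n ys) ≡ sumOfCubes (map (λ y → atℤ y n) ys)
ι-sumCubesAt n []       = refl
ι-sumCubesAt n (y ∷ ys) = cong₂ _⊕_ (ι-cubeT (at y n)) (ι-sumCubesAt n ys)

isSumOfCubes⁺ : ∀ {x ys} → (∀ n → atℤ x n ≡ sumOfCubes (map (λ y → atℤ y n) ys) mod 3# ^ n) → IsSumOfCubes x ys
isSumOfCubes⁺ {x} {ys} x≡Σys n = trans (sym (reduced x n)) (red-cong n (begin
  atℤ x n                              ≈⟨ x≡Σys n ⟩
  sumOfCubes (map (λ y → atℤ y n) ys)  ≡⟨ ι-sumCubesAt n ys ⟨
  ι (sumCubesAt n ys)                  ∎))
  where open ≡-mod-Reasoning (3# ^ n)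

RationalMod3 : Tri → Set
RationalMod3 (_ , b , c) = 3 ℕ.∣ b × 3 ℕ.∣ c

rationalMod3? : ∀ t → Dec (RationalMod3 t)
rationalMod3? (_ , b , c) = (3 ℕ.∣? b) ×-dec (3 ℕ.∣? c)

module _ where
  open import Data.Nat.Base using (_+_; _*_)

  cubeT-rationalMod3 : ∀ t → RationalMod3 (cubeT t)
  cubeT-rationalMod3 (a , b , c) =
    ℕ.divides (a * a * b + 3 * (a * c * c) + 3 * (b * b * c)) (π-coefficient a b c) ,
    ℕ.divides (a * a * c + a * b * b + 3 * (b * c * c)) (π²-coefficient a b c)
    where
    π-coefficient : ∀ a b c →
      a * (a * b + b * a + 3 * (c * c)) + b * (a * a + 3 * (b * c + c * b)) + 3 * (c * (a * c + b * b + c * a))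
        ≡ (a * a * b + 3 * (a * c * c) + 3 * (b * b * c)) * 3
    π-coefficient = ℕ-Solver.solve-∀
    π²-coefficient : ∀ a b c →
      a * (a * c + b * b + c * a) + b * (a * b + b * a + 3 * (c * c)) + c * (a * a + 3 * (b * c + c * b))
        ≡ (a * a * c + a * b * b + 3 * (b * c * c)) * 3
    π²-coefficient = ℕ-Solver.solve-∀

sumCubesAt-rationalMod3 : ∀ n ys → RationalMod3 (sumCubesAt n ys)
sumCubesAt-rationalMod3 n []       = 3 ℕ.∣0 , 3 ℕ.∣0
sumCubesAt-rationalMod3 n (y ∷ ys) with cubeT-rationalMod3 (at y n) | sumCubesAt-rationalMod3 n ys
... | 3∣b , 3∣c | 3∣b′ , 3∣c′ = ℕ.∣m∣n⇒∣m+n 3∣b 3∣b′ , ℕ.∣m∣n⇒∣m+n 3∣c 3∣c′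

red-rationalMod3 : ∀ n {t} → RationalMod3 t → RationalMod3 (red (suc n) t)
red-rationalMod3 n (3∣b , 3∣c) = ℕ.%-presˡ-∣ 3∣b (ℕ.m∣m*n (3 ℕ.^ n)) , ℕ.%-presˡ-∣ 3∣c (ℕ.m∣m*n (3 ℕ.^ n))
  where instance _ = ℕ.m^n≢0 3 (suc n)

residues : ℕ → List Tri
residues n = cartesianProduct (upTo n) (cartesianProduct (upTo n) (upTo n))

red∈residues : ∀ n t → red n t ∈ residues (3 ℕ.^ n)
red∈residues n (a , b , c) =
  ∈-cartesianProduct⁺ (∈-upTo⁺ (ℕ.m%n<n a (3 ℕ.^ n)))
    (∈-cartesianProduct⁺ (∈-upTo⁺ (ℕ.m%n<n b (3 ℕ.^ n))) (∈-upTo⁺ (ℕ.m%n<n c (3 ℕ.^ n))))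
  where instance _ = ℕ.m^n≢0 3 n

at∈residues : ∀ x n → at x n ∈ residues (3 ℕ.^ n)
at∈residues x n = subst (_∈ residues (3 ℕ.^ n)) (reduced x n) (red∈residues n (at x n))

_≟ᵀ_ : DecidableEquality Tri
_≟ᵀ_ = ≡-dec ℕ._≟_ (≡-dec ℕ._≟_ ℕ._≟_)

-- Their cubes 0, 1, 3, 24 are rational integers: they adjust the constant term left by r³.
smallCubeRoots : List Tri
smallCubeRoots = (0 , 0 , 0) ∷ (1 , 0 , 0) ∷ (0 , 1 , 0) ∷ (0 , 2 , 0) ∷ []

LiftableMod9 : Tri → Tri × Tri × Tri → Set
LiftableMod9 X (r , a , b) =
  red 2 (sumCubesT (r ∷ a ∷ b ∷ [])) ≡ X × Any (λ w → red 1 (mulT (mulT r r) w) ≡ (1 , 0 , 0)) (residues 3)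

liftable? : ∀ X rab → Dec (LiftableMod9 X rab)
liftable? X (r , a , b) =
  (red 2 (sumCubesT (r ∷ a ∷ b ∷ [])) ≟ᵀ X) ×-dec any? (λ w → red 1 (mulT (mulT r r) w) ≟ᵀ (1 , 0 , 0)) (residues 3)

-- Proofs by exhaustive computation, kept opaque so that using them never re-runs it.
opaque
  rationalMod3-liftable-mod-9 :
    All (λ X → RationalMod3 X → Any (LiftableMod9 X) (cartesianProduct (residues 3) (cartesianProduct smallCubeRoots smallCubeRoots)))
        (residues 9)
  rationalMod3-liftable-mod-9 =
    toWitness {a? = all? (λ X → rationalMod3? X →-dec any? (liftable? X) _) (residues 9)} _

  two-cubes-≢-3+3π²-mod-9 : All (λ q₁ → All (λ q₂ → red 2 (sumCubesT (q₁ ∷ q₂ ∷ [])) ≢ (3 , 0 , 3)) (residues 3)) (residues 3)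
  two-cubes-≢-3+3π²-mod-9 =
    toWitness {a? = all? (λ q₁ → all? (λ q₂ → ¬? (red 2 (sumCubesT (q₁ ∷ q₂ ∷ [])) ≟ᵀ (3 , 0 , 3))) (residues 3)) (residues 3)} _

isSumOfCubes-const : ∀ {t} ts → sumCubesT ts ≡ t → IsSumOfCubes (const t) (map const ts)
isSumOfCubes-const {t} ts Σts≡t = isSumOfCubes⁺ {const t} {map const ts} t≡Σts
  where
  approximations : ∀ n ts → Pointwise (_≡_mod 3# ^ n) (map ι ts) (map (λ y → atℤ y n) (map const ts))
  approximations n []       = []
  approximations n (t ∷ ts) = ≡-mod-sym (atℤ-const t n) ∷ approximations n ts
  t≡Σts : ∀ n → atℤ (const t) n ≡ sumOfCubes (map (λ y → atℤ y n) (map const ts)) mod 3# ^ n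
  t≡Σts n = begin
    atℤ (const t) n                                  ≈⟨ atℤ-const t n ⟩
    ι t                                              ≡⟨ cong ι Σts≡t ⟨
    ι (sumCubesT ts)                                 ≡⟨ ι-sumCubesT ts ⟩
    sumOfCubes (map ι ts)                            ≈⟨ sumOfCubes-≡-mod (approximations n ts) ⟩
    sumOfCubes (map (λ y → atℤ y n) (map const ts))  ∎
    where open ≡-mod-Reasoning (3# ^ n)

representation-mod-9 : ∀ x {ys} → IsSumOfCubes x ys →
  ∃[ r ] ∃[ a ] ∃[ b ] ∃[ w ]
    sumOfCubes (map ι (r ∷ a ∷ b ∷ [])) ≡ atℤ x 2 mod 3# ^ 2 × ι r ⊗ ι r ⊗ ι w ≡ ι (1 , 0 , 0) mod 3#
representation-mod-9 x {ys} x≡Σys =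
  let (r , a , b) , Σ≡x , w∈ = Any.satisfied (All.lookup rationalMod3-liftable-mod-9 (at∈residues x 2) x-rationalMod3)
      w , r²w≡1 = Any.satisfied w∈
  in  r , a , b , w ,
      ≡-mod-trans (≡-mod-reflexive (sym (ι-sumCubesT (r ∷ a ∷ b ∷ [])))) (≡-mod-red 2 Σ≡x) ,
      ≡-mod-trans (≡-mod-reflexive (sym (trans (ι-mulT (mulT r r) w) (cong (_⊗ ι w) (ι-mulT r r))))) (≡-mod-red 1 r²w≡1)
  where
  x-rationalMod3 : RationalMod3 (at x 2)
  x-rationalMod3 = subst RationalMod3 (sym (x≡Σys 2)) (red-rationalMod3 1 {sumCubesAt 2 ys} (sumCubesAt-rationalMod3 2 ys))

threeCubes-from-mod-9 : ∀ x r a b w → sumOfCubes (map ι (r ∷ a ∷ b ∷ [])) ≡ atℤ x 2 mod 3# ^ 2 →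
                        ι r ⊗ ι r ⊗ ι w ≡ ι (1 , 0 , 0) mod 3# → SumOfAtMost 3 x
threeCubes-from-mod-9 x r a b w r³+a³+b³≡x r²w≡1 =
  let root , root-coherent , root³+a³+b³≡x =
        hensel-cube (atℤ-coherent x) {sumOfCubes (map ι (a ∷ b ∷ []))} {ι r} {ι w} r³+a³+b³≡x r²w≡1
      cubeRoots = fromCoherent root root-coherent ∷ const a ∷ const b ∷ []
  in  cubeRoots , ℕ.≤-refl ,
      isSumOfCubes⁺ {x} {cubeRoots} λ n → ≡-mod-trans (≡-mod-sym (root³+a³+b³≡x n))
        (sumOfCubes-≡-mod (≡-mod-sym (atℤ-fromCoherent root root-coherent n) ∷ ≡-mod-sym (atℤ-const a n) ∷ ≡-mod-sym (atℤ-const b n) ∷ []))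

cubeSemigroup⊆threeCubes : (x : 𝒪) → InCubeSemigroup x → SumOfAtMost 3 x
cubeSemigroup⊆threeCubes x (ys , _ , x≡Σys) =
  let r , a , b , w , r³+a³+b³≡x , r²w≡1 = representation-mod-9 x {ys} x≡Σys
  in  threeCubes-from-mod-9 x r a b w r³+a³+b³≡x r²w≡1

x₀ : 𝒪
x₀ = const (21 , 18 , 12)

x₀∈cubeSemigroup : InCubeSemigroup x₀
x₀∈cubeSemigroup = map const cubeRoots , s≤s z≤n , isSumOfCubes-const cubeRoots refl
  where
  cubeRoots : List Tri
  cubeRoots = (0 , 1 , 0) ∷ (1 , 0 , 0) ∷ (2 , 0 , 1) ∷ []

sumCubesAt-mod-9-from-level-1 : ∀ ys → red 2 (sumCubesAt 2 ys) ≡ red 2 (sumCubesAt 1 ys)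
sumCubesAt-mod-9-from-level-1 ys = red-cong 2 (begin
  ι (sumCubesAt 2 ys)                  ≡⟨ ι-sumCubesAt 2 ys ⟩
  sumOfCubes (map (λ y → atℤ y 2) ys)  ≈⟨ sumOfCubes-≡-mod-3 (Pointwise.map⁺ {xs = ys} {ys = ys} (λ y → atℤ y 2) (λ y → atℤ y 1) (Pointwise.refl (λ {y} → atℤ-coherent y 1))) ⟩
  sumOfCubes (map (λ y → atℤ y 1) ys)  ≡⟨ ι-sumCubesAt 1 ys ⟨
  ι (sumCubesAt 1 ys)                  ∎)
  where open ≡-mod-Reasoning (3# ^ 2)

x₀-not-two-cubes : ¬ SumOfAtMost 2 x₀
x₀-not-two-cubes (ys , |ys|≤2 , x₀≡Σys) = atMostTwo ys |ys|≤2 (sym (trans (x₀≡Σys 2) (sumCubesAt-mod-9-from-level-1 ys)))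
  where
  no-two : ∀ {q₁ q₂} → q₁ ∈ residues 3 → q₂ ∈ residues 3 → red 2 (sumCubesT (q₁ ∷ q₂ ∷ [])) ≢ (3 , 0 , 3)
  no-two q₁∈ q₂∈ = All.lookup (All.lookup two-cubes-≢-3+3π²-mod-9 q₁∈) q₂∈
  atMostTwo : ∀ ys → length ys ≤ 2 → red 2 (sumCubesAt 1 ys) ≢ (3 , 0 , 3)
  atMostTwo []              _                   = no-two (here refl) (here refl)
  atMostTwo (y ∷ [])        _                   = no-two (at∈residues y 1) (here refl)
  atMostTwo (y₁ ∷ y₂ ∷ [])  _                   = no-two (at∈residues y₁ 1) (at∈residues y₂ 1)
  atMostTwo (_ ∷ _ ∷ _ ∷ _) (s≤s (s≤s ()))

theorem4p1 : ((x : 𝒪) → InCubeSemigroup x → SumOfAtMost 3 x)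
    × Σ 𝒪 (λ x → InCubeSemigroup x × ¬ SumOfAtMost 2 x)
theorem4p1 = cubeSemigroup⊆threeCubes , x₀ , x₀∈cubeSemigroup , x₀-not-two-cubes
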